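{- There exists $\alpha_0>0$ such that for every $\alpha\in(0,\alpha_0)$ there exists $\delta_0>0$ such that for every $\delta\in(0,\delta_0)$ there exists $n_0\in\mathbb N$ such that the following holds. Let $t,k,n \in \mathbb{N}$ with $n \geq n_0$ and $k^2 - k + 2 \leq n \leq k^2 + k + 1$. Let $\mathcal{H}$ be an $n$-vertex hypergraph with codegree at most $t$ in which every edge has size at least $(1 - \delta)\sqrt n$, and let $e, f \in \mathcal{H}$ be distinct edges of size at most $k$ with $V(e)\cap V(f)\neq\varnothing$ and $|V(e) \cap V(f)| \leq \alpha k$. If either (i) at least one of $e$ or $f$ has size at most $k-1$, (ii) $|V(e) \cap V(f)| \geq 2$, or (iii) there exists a vertex in $V(e) \cap V(f)$ which is contained in at most $t / (4 \delta)$ edges of size at most $k-1$, then $\{e,f \}$ is $t$-useful.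
   Context: A hypergraph $\mathcal H$ consists of a finite vertex set $V(\mathcal H)$ and a finite set of edges, each edge $e$ equipped with a non-empty set $V(e)\subseteq V(\mathcal H)$ (multiple edges allowed); $n$-vertex means $|V(\mathcal H)|=n$; the size of $e$ is $|V(e)|$. The codegree of $\mathcal H$ is the maximum over distinct vertices $u,v$ of the number of edges containing both. $N(e)$ is the set of edges $g\ne e$ with $V(e)\cap V(g)\neq\varnothing$. A pair $\{e,f\}$ of distinct edges of an $n$-vertex hypergraph is $t$-useful if $V(e)\cap V(f)\neq\varnothing$ and $|N(e)\cap N(f)|\le tn-3$.
   Formalization: The parameters α and δ range only over the rationals, and α₀ and δ₀ are taken in the rationals as well. -}

module Defs where

open import Data.Nat using (ℕ; zero; suc; _+_; _≤_; _<_)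
open import Data.Bool using (Bool; if_then_else_)
open import Data.Fin using (Fin; zero; suc; _≟_)
open import Data.Fin.Subset using (Subset; _∈_; _∩_; Nonempty; ∣_∣)
open import Data.Fin.Subset.Properties using (_∈?_; nonempty?)
open import Data.Product using (_×_)
open import Data.Sum using (_⊎_)
open import Data.Integer using (+_)
open import Data.Rational as ℚ using (ℚ; 0ℚ; 1ℚ; _-_)
open import Relation.Nullary using (¬_)
open import Relation.Nullary.Decidable using (⌊_⌋)
open import Data.Bool using (_∧_; not)
open import Relation.Binary.PropositionalEquality using (_≡_; _≢_)

⟦_⟧ : ℕ → ℚ
⟦ n ⟧ = + n ℚ./ 1

count : ∀ {m} → (Fin m → Bool) → ℕ
count {zero}  p = 0
count {suc m} p = (if p zero then 1 else 0) + count (λ i → p (suc i))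

-- A hypergraph on vertex set Fin n: m edges (multi-edges allowed),
-- edge e has non-empty vertex set V e.
record Hypergraph (n : ℕ) : Set where
  field
    m        : ℕ
    V        : Fin m → Subset n
    nonempty : ∀ e → Nonempty (V e)

module _ {n : ℕ} (H : Hypergraph n) where
  open Hypergraph H

  size : Fin m → ℕ
  size e = ∣ V e ∣

  meets : Fin m → Fin m → Bool
  meets e g = ⌊ nonempty? (V e ∩ V g) ⌋

  CodegreeAtMost : ℕ → Set
  CodegreeAtMost t = ∀ (u v : Fin n) → u ≢ v →
    count (λ e → ⌊ u ∈? V e ⌋ ∧ ⌊ v ∈? V e ⌋) ≤ t

  commonNbhdSize : Fin m → Fin m → ℕ
  commonNbhdSize e f = count (λ g →
    not ⌊ g ≟ e ⌋ ∧ meets e g ∧ not ⌊ g ≟ f ⌋ ∧ meets f g)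

  -- {e,f} is t-useful: e ≠ f, V(e) ∩ V(f) ≠ ∅ and |N(e) ∩ N(f)| ≤ t n - 3
  -- (the last inequality, taken over the integers, is written as
  --  |N(e) ∩ N(f)| + 3 ≤ t n)
  Useful : ℕ → Fin m → Fin m → Set
  Useful t e f = e ≢ f × Nonempty (V e ∩ V f) × commonNbhdSize e f + 3 ≤ t Data.Nat.* n

  smallEdgesAt : ℕ → Fin n → ℕ
  smallEdgesAt k v = count (λ g → ⌊ v ∈? V g ⌋ ∧ ⌊ Data.Nat._<?_ (size g) k ⌋)

-- s ≥ (1 - δ) √n, written without square roots:
-- either 1 - δ ≤ 0, or (1 - δ)² n ≤ s²  (both sides of the original are then ≥ 0)
AtLeastSqrtBound : ℚ → ℕ → ℕ → Set
AtLeastSqrtBound δ n s =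
  (1ℚ - δ) ℚ.≤ 0ℚ ⊎ ((1ℚ - δ) ℚ.* (1ℚ - δ)) ℚ.* ⟦ n ⟧ ℚ.≤ ⟦ s ⟧ ℚ.* ⟦ s ⟧

{-# OPTIONS --safe #-}
-- Write I = V e ∩ V f, A = V e ∖ V f and B = V f ∖ V e.  A common neighbour of e and f contains
-- a vertex of I, or a vertex of A together with a vertex of B; by the codegree bound there are at
-- most t·|A|·|B| of the second kind.  Double counting the pairs (g, z) with y, z ∈ g and z ≠ y
-- gives Σ_{g ∋ y} (|g| − 1) ≤ t(n − 1), and since every edge has size at least (1 − δ)√n ≈ (1 − δ)k
-- this bounds every degree by (5/4)·t(k + 1).  If |I| ≥ 2, or |I| = 1 and e or f has fewer than k
-- vertices, these estimates together with |I| ≤ αk already give |N(e) ∩ N(f)| ≤ tn − 3.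
-- Otherwise I = {v} and |e| = |f| = k, and the finer estimate
--   (k − 1)·deg v ≤ Σ_{g ∋ v} (|g| − 1) + Σ_{g ∋ v, |g| < k} (k − |g|) ≤ t(n − 1) + (δk + 1)·S,
-- where S ≤ t / (4δ) is the number of small edges at v, keeps deg v small enough.
module Submission where

open import Defs
open import Data.Nat using (ℕ; _+_; _*_; _∸_; _≤_; _<_; _≥_)
open import Data.Fin using (Fin)
open import Data.Fin.Subset using (_∈_; _∩_; Nonempty; ∣_∣)
open import Data.Product using (Σ; ∃; _×_; _,_)
open import Data.Sum using (_⊎_)
open import Data.Rational as ℚ using (ℚ; 0ℚ)
open import Relation.Binary.PropositionalEquality using (_≢_)

module Counting where

  open import Data.Bool.Base using (Bool; true; false; _∧_; not; if_then_else_)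
  open import Data.Bool.Properties using (∧-zeroʳ; ∧-identityʳ)
  open import Data.Fin.Base using (Fin; zero; suc)
  open import Data.Fin.Properties using (_≟_)
  import Data.Fin.Properties as Finₚ
  open import Data.Nat.Base using (ℕ; zero; suc; _+_; _*_; _≤_; z≤n; s≤s)
  open import Data.Nat.Properties hiding (_≟_)
  open import Algebra.Properties.Semiring.Sum +-*-semiring
    using (sum; sum-syntax; sum-cong-≗; *-distribˡ-sum; sum-replicate-zero)
  open import Data.Nat.Tactic.RingSolver using (solve-∀)
  open import Data.Product.Base using (∃-syntax; _,_; _×_)
  open import Function.Base using (_∘_)
  open import Relation.Binary.PropositionalEquality
  open import Relation.Nullary.Decidable using (Dec; ⌊_⌋; yes; no; dec-true; dec-false; isYes≗does; ⌊⌋-map′)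
  open import Relation.Nullary.Negation using (¬_; contradiction)

  private variable
    m : ℕ

  𝟙 : Bool → ℕ
  𝟙 b = if b then 1 else 0

  𝟙-mono : ∀ {a b} → (a ≡ true → b ≡ true) → 𝟙 a ≤ 𝟙 b
  𝟙-mono {true}  a⇒b rewrite a⇒b refl = ≤-refl
  𝟙-mono {false} _ = z≤n

  ∧-true₄ : ∀ {a b c d} → a ∧ b ∧ c ∧ d ≡ true → a ≡ true × b ≡ true × c ≡ true × d ≡ true
  ∧-true₄ {true} {true} {true} {true} _ = refl , refl , refl , refl

  ⌊⌋-true : ∀ {A : Set} (a? : Dec A) → A → ⌊ a? ⌋ ≡ true
  ⌊⌋-true a? a = trans (isYes≗does a?) (dec-true a? a)

  ⌊⌋-sound : ∀ {A : Set} (a? : Dec A) → ⌊ a? ⌋ ≡ true → A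
  ⌊⌋-sound (yes a) _ = a

  ⌊⌋-false : ∀ {A : Set} (a? : Dec A) → ¬ A → ⌊ a? ⌋ ≡ false
  ⌊⌋-false a? ¬a = trans (isYes≗does a?) (dec-false a? ¬a)

  ≟-suc : (i j : Fin m) → ⌊ suc i ≟ suc j ⌋ ≡ ⌊ i ≟ j ⌋
  ≟-suc i j = ⌊⌋-map′ (cong suc) Finₚ.suc-injective (i ≟ j)

  ∑-mono-≤ : {f g : Fin m → ℕ} → (∀ i → f i ≤ g i) → sum f ≤ sum g
  ∑-mono-≤ {zero}  f≤g = z≤n
  ∑-mono-≤ {suc m} f≤g = +-mono-≤ (f≤g zero) (∑-mono-≤ (f≤g ∘ suc))

  ∑-zero : {f : Fin m → ℕ} → (∀ i → f i ≡ 0) → sum f ≡ 0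
  ∑-zero {zero}  f≗0 = refl
  ∑-zero {suc m} f≗0 = cong₂ _+_ (f≗0 zero) (∑-zero (f≗0 ∘ suc))

  term≤∑ : (f : Fin m → ℕ) (i : Fin m) → f i ≤ sum f
  term≤∑ f zero    = m≤m+n _ _
  term≤∑ f (suc i) = ≤-trans (term≤∑ (f ∘ suc) i) (m≤n+m _ _)

  ∑-indicator : (a : Fin m) (x : ℕ) → ∑[ i < m ] (if ⌊ i ≟ a ⌋ then x else 0) ≡ x
  ∑-indicator {suc m} zero    x = trans (cong (x +_) (sum-replicate-zero m)) (+-identityʳ x)
  ∑-indicator {suc m} (suc a) x =
    trans (sum-cong-≗ (λ i → cong (if_then x else 0) (≟-suc i a))) (∑-indicator a x)

  *-if : ∀ a b x → a * (if b then x else 0) ≡ (if b then a * x else 0)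
  *-if a true  x = refl
  *-if a false x = *-zeroʳ a

  *-∑-if : ∀ a (P : Fin m → Bool) (w : Fin m → ℕ) →
           a * ∑[ i < m ] (if P i then w i else 0) ≡ ∑[ i < m ] (if P i then a * w i else 0)
  *-∑-if a P w = trans (*-distribˡ-sum a (λ i → if P i then w i else 0)) (sum-cong-≗ (λ i → *-if a (P i) (w i)))

  count≡∑ : (P : Fin m → Bool) → count P ≡ ∑[ i < m ] 𝟙 (P i)
  count≡∑ {zero}  P = refl
  count≡∑ {suc m} P = cong (𝟙 (P zero) +_) (count≡∑ (P ∘ suc))

  *-count≡∑ : ∀ c (P : Fin m → Bool) → c * count P ≡ ∑[ i < m ] (c * 𝟙 (P i))
  *-count≡∑ c P = trans (cong (c *_) (count≡∑ P)) (*-distribˡ-sum c (𝟙 ∘ P))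

  count-cong : {P Q : Fin m → Bool} → (∀ i → P i ≡ Q i) → count P ≡ count Q
  count-cong {zero}  P≗Q = refl
  count-cong {suc m} P≗Q = cong₂ _+_ (cong 𝟙 (P≗Q zero)) (count-cong (P≗Q ∘ suc))

  count-mono : {P Q : Fin m → Bool} → (∀ i → P i ≡ true → Q i ≡ true) → count P ≤ count Q
  count-mono {zero}  P⇒Q = z≤n
  count-mono {suc m} P⇒Q = +-mono-≤ (𝟙-mono (P⇒Q zero)) (count-mono (P⇒Q ∘ suc))

  count-false : count {m} (λ _ → false) ≡ 0
  count-false {zero}  = refl
  count-false {suc m} = count-false {m}

  count-true : count {m} (λ _ → true) ≡ m
  count-true {zero}  = refl
  count-true {suc m} = cong suc (count-true {m})

  count-∧ˡ : ∀ b (P : Fin m → Bool) → count (λ i → b ∧ P i) ≡ (if b then count P else 0)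
  count-∧ˡ true  P = refl
  count-∧ˡ {m} false P = count-false {m}

  count-∧-split : (P Q : Fin m → Bool) →
                  count P ≡ count (λ i → P i ∧ Q i) + count (λ i → P i ∧ not (Q i))
  count-∧-split {zero}  P Q = refl
  count-∧-split {suc m} P Q
    rewrite count-∧-split (P ∘ suc) (Q ∘ suc) with P zero | Q zero
  ... | true  | true  = refl
  ... | true  | false = sym (+-suc _ _)
  ... | false | _     = refl

  count-remove : (P : Fin m → Bool) (a : Fin m) →
                 count P ≡ 𝟙 (P a) + count (λ i → P i ∧ not ⌊ i ≟ a ⌋)
  count-remove {suc m} P zero = cong (𝟙 (P zero) +_) (begin
    count (P ∘ suc)                       ≡⟨ count-cong (λ i → sym (∧-identityʳ (P (suc i)))) ⟩
    count (λ i → P (suc i) ∧ true)        ≡⟨ cong (_+ count (λ i → P (suc i) ∧ true)) (cong 𝟙 (∧-zeroʳ (P zero))) ⟨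
    𝟙 (P zero ∧ false) + count (λ i → P (suc i) ∧ true) ∎)
    where open ≡-Reasoning
  count-remove {suc m} P (suc a) = begin
    𝟙 (P zero) + count (P ∘ suc)                       ≡⟨ cong (𝟙 (P zero) +_) (count-remove (P ∘ suc) a) ⟩
    𝟙 (P zero) + (𝟙 (P (suc a)) + count Rest)          ≡⟨ swap (𝟙 (P zero)) (𝟙 (P (suc a))) (count Rest) ⟩
    𝟙 (P (suc a)) + (𝟙 (P zero) + count Rest)          ≡⟨ cong (λ b → 𝟙 (P (suc a)) + (𝟙 b + count Rest)) (∧-identityʳ (P zero)) ⟨
    𝟙 (P (suc a)) + (𝟙 (P zero ∧ true) + count Rest)   ≡⟨ cong (λ c → 𝟙 (P (suc a)) + (𝟙 (P zero ∧ true) + c))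
                                                              (count-cong (λ i → cong (λ b → P (suc i) ∧ not b) (≟-suc i a))) ⟨
    𝟙 (P (suc a)) + count (λ i → P i ∧ not ⌊ i ≟ suc a ⌋) ∎
    where
    open ≡-Reasoning
    Rest : Fin m → Bool
    Rest i = P (suc i) ∧ not ⌊ i ≟ a ⌋
    swap : ∀ x y z → x + (y + z) ≡ y + (x + z)
    swap = solve-∀

  witness⇒1≤count : (P : Fin m → Bool) (a : Fin m) → P a ≡ true → 1 ≤ count P
  witness⇒1≤count P a Pa =
    subst (1 ≤_) (sym (count-remove P a)) (subst (λ b → 1 ≤ 𝟙 b + count (λ i → P i ∧ not ⌊ i ≟ a ⌋)) (sym Pa) (s≤s z≤n))

  1≤∑𝟙 : (P : Fin m → Bool) (a : Fin m) → P a ≡ true → 1 ≤ ∑[ i < m ] 𝟙 (P i)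
  1≤∑𝟙 P a Pa = subst (1 ≤_) (count≡∑ P) (witness⇒1≤count P a Pa)

  1≤count⇒witness : (P : Fin m → Bool) → 1 ≤ count P → ∃[ a ] P a ≡ true
  1≤count⇒witness {suc m} P 1≤c with P zero in Pz
  ... | true  = zero , Pz
  ... | false with 1≤count⇒witness (P ∘ suc) 1≤c
  ...   | a , Pa = suc a , Pa

  unique-of-count≤1 : (P : Fin m → Bool) → count P ≤ 1 →
                      ∀ {a b} → P a ≡ true → P b ≡ true → b ≡ a
  unique-of-count≤1 P c≤1 {a} {b} Pa Pb with b ≟ a
  ... | yes b≡a = b≡a
  ... | no  b≢a = contradiction c≤1 (<⇒≱ (begin-strict
    1                     <⟨ s≤s (witness⇒1≤count Rest b b∈Rest) ⟩
    1 + count Rest        ≡⟨ cong (λ x → 𝟙 x + count Rest) Pa ⟨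
    𝟙 (P a) + count Rest  ≡⟨ count-remove P a ⟨
    count P               ∎))
    where
    open ≤-Reasoning
    Rest : Fin _ → Bool
    Rest i = P i ∧ not ⌊ i ≟ a ⌋
    b∈Rest : Rest b ≡ true
    b∈Rest = cong₂ (λ x y → x ∧ not y) Pb (⌊⌋-false (b ≟ a) b≢a)

  *-count≤∑ : ∀ c {P : Fin m → Bool} (w : Fin m → ℕ) → (∀ i → P i ≡ true → c ≤ w i) →
              c * count P ≤ ∑[ i < m ] (if P i then w i else 0)
  *-count≤∑ c {P} w c≤w = ≤-trans (≤-reflexive (*-count≡∑ c P)) (∑-mono-≤ pointwise)
    where
    pointwise : ∀ i → c * 𝟙 (P i) ≤ (if P i then w i else 0)
    pointwise i with P i in Pi
    ... | true  = ≤-trans (≤-reflexive (*-identityʳ c)) (c≤w i Pi)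
    ... | false = ≤-reflexive (*-zeroʳ c)

  ∑≤*-count : ∀ c {P : Fin m → Bool} (w : Fin m → ℕ) → (∀ i → P i ≡ true → w i ≤ c) →
              ∑[ i < m ] (if P i then w i else 0) ≤ c * count P
  ∑≤*-count c {P} w w≤c = ≤-trans (∑-mono-≤ pointwise) (≤-reflexive (sym (*-count≡∑ c P)))
    where
    pointwise : ∀ i → (if P i then w i else 0) ≤ c * 𝟙 (P i)
    pointwise i with P i in Pi
    ... | true  = ≤-trans (w≤c i Pi) (≤-reflexive (sym (*-identityʳ c)))
    ... | false = z≤n

  ∑≤-single-support : {P : Fin m → Bool} (w : Fin m → ℕ) (a : Fin m) → (∀ i → P i ≡ true → i ≡ a) →
                      ∑[ i < m ] (if P i then w i else 0) ≤ w a
  ∑≤-single-support {P = P} w a only-a = ≤-trans (∑-mono-≤ pointwise) (≤-reflexive (∑-indicator a (w a)))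
    where
    pointwise : ∀ i → (if P i then w i else 0) ≤ (if ⌊ i ≟ a ⌋ then w a else 0)
    pointwise i with P i in Pi
    ... | false = z≤n
    ... | true rewrite only-a i Pi | ⌊⌋-true (a ≟ a) refl = ≤-refl

module HypergraphCounting where

  open Counting
  open import Data.Bool.Base using (Bool; true; false; _∧_; not; if_then_else_)
  open import Data.Bool.Properties using (∧-zeroʳ; ∧-identityʳ; ∧-conicalˡ; ∧-conicalʳ; ∧-comm)
  open import Data.Fin.Base using (Fin; suc)
  open import Data.Fin.Properties using (_≟_)
  open import Data.Fin.Subset using (Subset; _∩_; inside; outside; ∣_∣)
  open import Data.Fin.Subset.Properties using (_∈?_; nonempty?; x∈p∩q⁺; p∩q⊆p; p∩q⊆q; drop-there)
  open import Data.Nat.Base using (ℕ; suc; _+_; _*_; _∸_; _≤_; _<_; z≤n)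
  open import Data.Nat.Properties hiding (_≟_)
  open import Algebra.Properties.Semiring.Sum +-*-semiring using (sum; sum-syntax; sum-cong-≗; ∑-distrib-+; ∑-comm)
  open import Data.Product.Base using (∃-syntax; _,_; _×_)
  open import Data.Sum.Base using (_⊎_; inj₁; inj₂)
  open import Data.Vec.Base using ([]; _∷_)
  open import Function.Base using (_∘_)
  open import Relation.Binary.PropositionalEquality
  open import Relation.Nullary.Decidable using (⌊_⌋; yes; no; ⌊⌋-map′)

  private variable
    n : ℕ

  _∈ᵇ_ : Fin n → Subset n → Bool
  y ∈ᵇ p = ⌊ y ∈? p ⌋

  ∈ᵇ-∩ : (y : Fin n) (p q : Subset n) → y ∈ᵇ (p ∩ q) ≡ y ∈ᵇ p ∧ y ∈ᵇ q
  ∈ᵇ-∩ y p q with y ∈? p | y ∈? q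
  ... | yes y∈p | yes y∈q = ⌊⌋-true (y ∈? p ∩ q) (x∈p∩q⁺ (y∈p , y∈q))
  ... | yes _   | no  y∉q = ⌊⌋-false (y ∈? p ∩ q) (y∉q ∘ p∩q⊆q p q)
  ... | no  y∉p | _       = ⌊⌋-false (y ∈? p ∩ q) (y∉p ∘ p∩q⊆p p q)

  ∈ᵇ-there : ∀ (y : Fin n) b p → suc y ∈ᵇ (b ∷ p) ≡ y ∈ᵇ p
  ∈ᵇ-there y b p = ⌊⌋-map′ _ drop-there (y ∈? p)

  ∣∣≡count-∈ᵇ : (p : Subset n) → ∣ p ∣ ≡ count (_∈ᵇ p)
  ∣∣≡count-∈ᵇ []            = refl
  ∣∣≡count-∈ᵇ (inside  ∷ p) = cong suc (trans (∣∣≡count-∈ᵇ p) (count-cong (λ y → sym (∈ᵇ-there y inside p))))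
  ∣∣≡count-∈ᵇ (outside ∷ p) = trans (∣∣≡count-∈ᵇ p) (count-cong (λ y → sym (∈ᵇ-there y outside p)))

  module _ (H : Hypergraph n) where
    open Hypergraph H

    degree : Fin n → ℕ
    degree y = count (λ g → y ∈ᵇ V g)

    pairsThrough : Fin n → ℕ
    pairsThrough y = ∑[ g < m ] (if y ∈ᵇ V g then size H g ∸ 1 else 0)

    deficitAt : ℕ → Fin n → ℕ
    deficitAt k y = ∑[ g < m ] (if y ∈ᵇ V g ∧ ⌊ size H g <? k ⌋ then k ∸ size H g else 0)

    size≡suc-others : ∀ {y g} → y ∈ᵇ V g ≡ true → size H g ≡ suc (count (λ z → z ∈ᵇ V g ∧ not ⌊ z ≟ y ⌋))
    size≡suc-others {y} {g} y∈g = begin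
      size H g                                            ≡⟨ ∣∣≡count-∈ᵇ (V g) ⟩
      count (_∈ᵇ V g)                                     ≡⟨ count-remove (_∈ᵇ V g) y ⟩
      𝟙 (y ∈ᵇ V g) + count Others                         ≡⟨ cong (λ b → 𝟙 b + count Others) y∈g ⟩
      suc (count Others)                                  ∎
      where
      open ≡-Reasoning
      Others : Fin n → Bool
      Others z = z ∈ᵇ V g ∧ not ⌊ z ≟ y ⌋

    pairsThrough+t≤t*n : ∀ {t} → CodegreeAtMost H t → (y : Fin n) → pairsThrough y + t ≤ t * n
    pairsThrough+t≤t*n {t} cod y = begin
      pairsThrough y + t                                  ≡⟨ cong (_+ t) (sum-cong-≗ as-count) ⟩
      ∑[ g < m ] count (λ z → Shared z g) + t             ≡⟨ cong (_+ t) (sum-cong-≗ (λ g → count≡∑ (λ z → Shared z g))) ⟩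
      ∑[ g < m ] ∑[ z < n ] 𝟙 (Shared z g) + t           ≡⟨ cong (_+ t) (∑-comm (λ g z → 𝟙 (Shared z g))) ⟩
      ∑[ z < n ] ∑[ g < m ] 𝟙 (Shared z g) + t           ≡⟨ cong (_+ t) (sum-cong-≗ (λ z → sym (count≡∑ (Shared z)))) ⟩
      ∑[ z < n ] count (Shared z) + t                     ≤⟨ +-monoˡ-≤ t (∑-mono-≤ codegree-bound) ⟩
      ∑[ z < n ] (t * 𝟙 (not ⌊ z ≟ y ⌋)) + t             ≡⟨ cong (_+ t) (*-count≡∑ t (λ z → not ⌊ z ≟ y ⌋)) ⟨
      t * count (λ z → not ⌊ z ≟ y ⌋) + t                 ≡⟨ +-comm _ t ⟩
      t + t * count (λ z → not ⌊ z ≟ y ⌋)                 ≡⟨ *-suc t _ ⟨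
      t * suc (count (λ z → not ⌊ z ≟ y ⌋))               ≡⟨ cong (t *_) (trans (sym (count-remove (λ _ → true) y)) count-true) ⟩
      t * n                                               ∎
      where
      open ≤-Reasoning
      Shared : Fin n → Fin m → Bool
      Shared z g = y ∈ᵇ V g ∧ (z ∈ᵇ V g ∧ not ⌊ z ≟ y ⌋)
      as-count : ∀ g → (if y ∈ᵇ V g then size H g ∸ 1 else 0) ≡ count (λ z → Shared z g)
      as-count g with y ∈ᵇ V g in y∈g
      ... | true  = cong (_∸ 1) (size≡suc-others y∈g)
      ... | false = sym (count-false {n})
      codegree-bound : ∀ z → count (Shared z) ≤ t * 𝟙 (not ⌊ z ≟ y ⌋)
      codegree-bound z with z ≟ y
      ... | yes _   = ≤-reflexive (trans (count-cong (λ g → trans (cong (y ∈ᵇ V g ∧_) (∧-zeroʳ _)) (∧-zeroʳ _)))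
                                         (trans (count-false {m}) (sym (*-zeroʳ t))))
      ... | no  z≢y = ≤-trans (≤-reflexive (count-cong (λ g → cong (y ∈ᵇ V g ∧_) (∧-identityʳ (z ∈ᵇ V g)))))
                              (≤-trans (cod y z (z≢y ∘ sym)) (≤-reflexive (sym (*-identityʳ t))))

    *-degree≤*-pairsThrough : ∀ c a y → (∀ g → y ∈ᵇ V g ≡ true → c ≤ a * (size H g ∸ 1)) →
                              c * degree y ≤ a * pairsThrough y
    *-degree≤*-pairsThrough c a y c≤ =
      ≤-trans (*-count≤∑ c (λ g → a * (size H g ∸ 1)) c≤) (≤-reflexive (sym (*-∑-if a (λ g → y ∈ᵇ V g) (λ g → size H g ∸ 1))))

    *-degree≤pairsThrough+deficitAt : ∀ k y → k * degree y ≤ pairsThrough y + deficitAt (suc k) y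
    *-degree≤pairsThrough+deficitAt k y = begin
      k * degree y                                   ≡⟨ *-count≡∑ k (λ g → y ∈ᵇ V g) ⟩
      ∑[ g < m ] (k * 𝟙 (y ∈ᵇ V g))                  ≤⟨ ∑-mono-≤ pointwise ⟩
      ∑[ g < m ] (pairs g + deficit g)               ≡⟨ ∑-distrib-+ pairs deficit ⟩
      pairsThrough y + deficitAt (suc k) y           ∎
      where
      open ≤-Reasoning
      pairs deficit : Fin m → ℕ
      pairs g = if y ∈ᵇ V g then size H g ∸ 1 else 0
      deficit g = if y ∈ᵇ V g ∧ ⌊ size H g <? suc k ⌋ then suc k ∸ size H g else 0
      pointwise : ∀ g → k * 𝟙 (y ∈ᵇ V g) ≤ pairs g + deficit g
      pointwise g with y ∈ᵇ V g in y∈g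
      ... | false = ≤-reflexive (*-zeroʳ k)
      ... | true  rewrite size≡suc-others y∈g = ≤-trans (≤-reflexive (*-identityʳ k)) (pred+shortfall _)
        where
        pred+shortfall : ∀ s → k ≤ s + (if ⌊ suc s <? suc k ⌋ then suc k ∸ suc s else 0)
        pred+shortfall s with suc s <? suc k
        ... | yes s<k = ≤-reflexive (sym (m+[n∸m]≡n (≤-pred (<⇒≤ s<k))))
        ... | no  s≮k = ≤-trans (≤-pred (≮⇒≥ s≮k)) (m≤m+n s 0)

    *-deficitAt≤*-smallEdgesAt : ∀ {q M} k y → (∀ g → q * (k ∸ size H g) ≤ M) →
                                 q * deficitAt k y ≤ M * smallEdgesAt H k y
    *-deficitAt≤*-smallEdgesAt {q} {M} k y bound =
      ≤-trans (≤-reflexive (*-∑-if q Small (λ g → k ∸ size H g))) (∑≤*-count M _ (λ g _ → bound g))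
      where
      Small : Fin m → Bool
      Small g = y ∈ᵇ V g ∧ ⌊ size H g <? k ⌋

    codegree-positive : ∀ {t y g} → CodegreeAtMost H t → y ∈ᵇ V g ≡ true → 2 ≤ size H g → 1 ≤ t
    codegree-positive {t} {y} {g} cod y∈g 2≤size
      with 1≤count⇒witness (λ z → z ∈ᵇ V g ∧ not ⌊ z ≟ y ⌋) (≤-pred (subst (2 ≤_) (size≡suc-others y∈g) 2≤size))
    ... | z , z∈g∧z≢y = ≤-trans (witness⇒1≤count _ g (cong₂ _∧_ y∈g z∈g)) (cod y z y≢z)
      where
      z∈g : z ∈ᵇ V g ≡ true
      z∈g = ∧-conicalˡ _ _ z∈g∧z≢y
      y≢z : y ≢ z
      y≢z refl with trans (cong not (sym (⌊⌋-true (y ≟ y) refl))) (∧-conicalʳ _ _ z∈g∧z≢y)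
      ... | ()

    meets⇒witness : ∀ a g → meets H a g ≡ true → ∃[ u ] u ∈ᵇ V a ≡ true × u ∈ᵇ V g ≡ true
    meets⇒witness a g a∩g with ⌊⌋-sound (nonempty? (V a ∩ V g)) a∩g
    ... | u , u∈a∩g = u , ∧-conicalˡ _ _ u∈a∧g , ∧-conicalʳ _ _ u∈a∧g
      where
      u∈a∧g : u ∈ᵇ V a ∧ u ∈ᵇ V g ≡ true
      u∈a∧g = trans (sym (∈ᵇ-∩ u (V a) (V g))) (⌊⌋-true (u ∈? V a ∩ V g) u∈a∩g)

    module _ (e f : Fin m) where

      inBoth inE∖F inF∖E : Fin n → Bool
      inBoth y = y ∈ᵇ V e ∧ y ∈ᵇ V f
      inE∖F  y = y ∈ᵇ V e ∧ not (y ∈ᵇ V f)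
      inF∖E  y = y ∈ᵇ V f ∧ not (y ∈ᵇ V e)

      otherEdgesAt : Fin n → ℕ
      otherEdgesAt y = count (λ g → (y ∈ᵇ V g ∧ not ⌊ g ≟ e ⌋) ∧ not ⌊ g ≟ f ⌋)

      otherEdgesAt≤degree : ∀ y → otherEdgesAt y ≤ degree y
      otherEdgesAt≤degree y = count-mono {P = λ g → (y ∈ᵇ V g ∧ not ⌊ g ≟ e ⌋) ∧ not ⌊ g ≟ f ⌋}
                                         (λ g yg → ∧-conicalˡ (y ∈ᵇ V g) _ (∧-conicalˡ _ (not ⌊ g ≟ f ⌋) yg))

      ∣V∩V∣≡count-inBoth : ∣ V e ∩ V f ∣ ≡ count inBoth
      ∣V∩V∣≡count-inBoth = trans (∣∣≡count-∈ᵇ (V e ∩ V f)) (count-cong (λ y → ∈ᵇ-∩ y (V e) (V f)))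

      size≡inE∖F+inBoth : size H e ≡ count inE∖F + count inBoth
      size≡inE∖F+inBoth = trans (∣∣≡count-∈ᵇ (V e))
        (trans (count-∧-split (_∈ᵇ V e) (_∈ᵇ V f)) (+-comm (count inBoth) (count inE∖F)))

      size≡inF∖E+inBoth : size H f ≡ count inF∖E + count inBoth
      size≡inF∖E+inBoth = trans (∣∣≡count-∈ᵇ (V f))
        (trans (count-∧-split (_∈ᵇ V f) (_∈ᵇ V e))
          (trans (+-comm _ (count inF∖E)) (cong (count inF∖E +_) (count-cong (λ y → ∧-comm (y ∈ᵇ V f) (y ∈ᵇ V e))))))

      degree≡2+otherEdgesAt : e ≢ f → ∀ {y} → inBoth y ≡ true → degree y ≡ 2 + otherEdgesAt y
      degree≡2+otherEdgesAt e≢f {y} y∈e∩f = begin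
        degree y                                             ≡⟨ count-remove (λ g → y ∈ᵇ V g) e ⟩
        𝟙 (y ∈ᵇ V e) + count NotE                            ≡⟨ cong (λ b → 𝟙 b + count NotE) (∧-conicalˡ _ _ y∈e∩f) ⟩
        1 + count NotE                                       ≡⟨ cong (1 +_) (count-remove NotE f) ⟩
        1 + (𝟙 (NotE f) + otherEdgesAt y)                    ≡⟨ cong (λ b → 1 + (𝟙 b + otherEdgesAt y)) f∈NotE ⟩
        2 + otherEdgesAt y                                   ∎
        where
        open ≡-Reasoning
        NotE : Fin m → Bool
        NotE g = y ∈ᵇ V g ∧ not ⌊ g ≟ e ⌋
        f∈NotE : NotE f ≡ true
        f∈NotE = cong₂ _∧_ (∧-conicalʳ _ _ y∈e∩f) (cong not (⌊⌋-false (f ≟ e) (e≢f ∘ sym)))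

      IsCommon : Fin m → Bool
      IsCommon g = not ⌊ g ≟ e ⌋ ∧ meets H e g ∧ not ⌊ g ≟ f ⌋ ∧ meets H f g

      ThroughBoth : Fin n → Fin m → Bool
      ThroughBoth y g = inBoth y ∧ ((y ∈ᵇ V g ∧ not ⌊ g ≟ e ⌋) ∧ not ⌊ g ≟ f ⌋)

      Across : Fin n → Fin n → Fin m → Bool
      Across u v g = inE∖F u ∧ (inF∖E v ∧ (u ∈ᵇ V g ∧ v ∈ᵇ V g))

      through-both : ∀ {y g} → not ⌊ g ≟ e ⌋ ≡ true → not ⌊ g ≟ f ⌋ ≡ true →
                     y ∈ᵇ V e ≡ true → y ∈ᵇ V f ≡ true → y ∈ᵇ V g ≡ true → ThroughBoth y g ≡ true
      through-both g≢e g≢f y∈e y∈f y∈g = cong₂ _∧_ (cong₂ _∧_ y∈e y∈f) (cong₂ _∧_ (cong₂ _∧_ y∈g g≢e) g≢f)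

      IsCommon-parts : ∀ g → IsCommon g ≡ true →
        not ⌊ g ≟ e ⌋ ≡ true × meets H e g ≡ true × not ⌊ g ≟ f ⌋ ≡ true × meets H f g ≡ true
      IsCommon-parts g = ∧-true₄ {not ⌊ g ≟ e ⌋} {meets H e g} {not ⌊ g ≟ f ⌋} {meets H f g}

      common-witness : ∀ {g} → IsCommon g ≡ true →
                       (∃[ y ] ThroughBoth y g ≡ true) ⊎ (∃[ u ] ∃[ v ] Across u v g ≡ true)
      common-witness {g} common with IsCommon-parts g common
      ... | g≢e , e∩g , g≢f , f∩g with meets⇒witness e g e∩g | meets⇒witness f g f∩g
      ... | u , u∈e , u∈g | v , v∈f , v∈g with u ∈ᵇ V f in u∈f | v ∈ᵇ V e in v∈e
      ... | true  | _     = inj₁ (u , through-both g≢e g≢f u∈e u∈f u∈g)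
      ... | false | true  = inj₁ (v , through-both g≢e g≢f v∈e v∈f v∈g)
      ... | false | false = inj₂ (u , v , cong₂ _∧_ (cong₂ _∧_ u∈e (cong not u∈f))
                                          (cong₂ _∧_ (cong₂ _∧_ v∈f (cong not v∈e)) (cong₂ _∧_ u∈g v∈g)))

      commonNbhdSize≤through+across :
        commonNbhdSize H e f ≤ ∑[ y < n ] count (ThroughBoth y) + ∑[ u < n ] ∑[ v < n ] count (Across u v)
      commonNbhdSize≤through+across = begin
        commonNbhdSize H e f                                          ≡⟨ count≡∑ IsCommon ⟩
        ∑[ g < m ] 𝟙 (IsCommon g)                                     ≤⟨ ∑-mono-≤ covered ⟩
        ∑[ g < m ] (through g + across g)                             ≡⟨ ∑-distrib-+ through across ⟩
        ∑[ g < m ] through g + ∑[ g < m ] across g                    ≡⟨ cong₂ _+_ swap-through swap-across ⟩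
        ∑[ y < n ] count (ThroughBoth y) + ∑[ u < n ] ∑[ v < n ] count (Across u v) ∎
        where
        open ≤-Reasoning
        through across : Fin m → ℕ
        through g = ∑[ y < n ] 𝟙 (ThroughBoth y g)
        across  g = ∑[ u < n ] ∑[ v < n ] 𝟙 (Across u v g)
        covered : ∀ g → 𝟙 (IsCommon g) ≤ through g + across g
        covered g with IsCommon g in common
        ... | false = z≤n
        ... | true with common-witness common
        ...   | inj₁ (y , y-through) = ≤-trans (1≤∑𝟙 (λ y′ → ThroughBoth y′ g) y y-through) (m≤m+n _ _)
        ...   | inj₂ (u , v , uv-across) =
                ≤-trans (≤-trans (1≤∑𝟙 (λ v′ → Across u v′ g) v uv-across) (term≤∑ _ u)) (m≤n+m _ _)
        swap-through : ∑[ g < m ] through g ≡ ∑[ y < n ] count (ThroughBoth y)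
        swap-through = trans (∑-comm (λ g y → 𝟙 (ThroughBoth y g))) (sum-cong-≗ (λ y → sym (count≡∑ (ThroughBoth y))))
        swap-across : ∑[ g < m ] across g ≡ ∑[ u < n ] ∑[ v < n ] count (Across u v)
        swap-across = trans (∑-comm (λ g u → ∑[ v < n ] 𝟙 (Across u v g)))
          (sum-cong-≗ (λ u → trans (∑-comm (λ g v → 𝟙 (Across u v g))) (sum-cong-≗ (λ v → sym (count≡∑ (Across u v))))))

      ∑-through≡ : ∑[ y < n ] count (ThroughBoth y) ≡ ∑[ y < n ] (if inBoth y then otherEdgesAt y else 0)
      ∑-through≡ = sum-cong-≗ (λ y → count-∧ˡ (inBoth y) (λ g → (y ∈ᵇ V g ∧ not ⌊ g ≟ e ⌋) ∧ not ⌊ g ≟ f ⌋))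

      ∑-across≤ : ∀ {t} → CodegreeAtMost H t →
                  ∑[ u < n ] ∑[ v < n ] count (Across u v) ≤ (t * count inF∖E) * count inE∖F
      ∑-across≤ {t} cod = ≤-trans (∑-mono-≤ across-from) (∑≤*-count (t * count inF∖E) {inE∖F} _ (λ _ _ → ≤-refl))
        where
        across-from : ∀ u → ∑[ v < n ] count (Across u v) ≤ (if inE∖F u then t * count inF∖E else 0)
        across-from u with inE∖F u in u∈E∖F
        ... | false = ≤-reflexive (∑-zero {f = λ v → count (λ g → false ∧ (inF∖E v ∧ (u ∈ᵇ V g ∧ v ∈ᵇ V g)))}
                                          (λ _ → count-false {m}))
        ... | true  = ≤-trans (≤-reflexive (sum-cong-≗ (λ v → count-∧ˡ (inF∖E v) (λ g → u ∈ᵇ V g ∧ v ∈ᵇ V g))))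
                              (∑≤*-count t {inF∖E} _ (λ v v∈F∖E → cod u v (u≢v v∈F∖E)))
          where
          u≢v : ∀ {v} → inF∖E v ≡ true → u ≢ v
          u≢v v∈F∖E refl with trans (sym (∧-conicalʳ (u ∈ᵇ V e) _ u∈E∖F)) (cong not (∧-conicalˡ (u ∈ᵇ V f) _ v∈F∖E))
          ... | ()

      commonNbhdSize≤ : ∀ {t} → CodegreeAtMost H t →
        commonNbhdSize H e f ≤ ∑[ y < n ] (if inBoth y then otherEdgesAt y else 0) + (t * count inF∖E) * count inE∖F
      commonNbhdSize≤ cod =
        ≤-trans commonNbhdSize≤through+across (+-mono-≤ (≤-reflexive ∑-through≡) (∑-across≤ cod))

module Inequalities where

  open import Data.Nat.Base using (ℕ; suc; _+_; _*_; _∸_; _≤_; _<_; z≤n; s≤s; s≤s⁻¹; >-nonZero; NonZero)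
  open import Data.Nat.Properties
  open import Data.Nat.Tactic.RingSolver using (solve-∀)
  open import Data.Sum.Base using (_⊎_; inj₁; inj₂)
  open import Relation.Binary.PropositionalEquality
  open import Relation.Nullary.Negation using (contradiction)

  open ≤-Reasoning

  m*m≤n*n⇒m≤n : ∀ m n → m * m ≤ n * n → m ≤ n
  m*m≤n*n⇒m≤n m n m²≤n² with ≤-<-connex m n
  ... | inj₁ m≤n = m≤n
  ... | inj₂ n<m = contradiction m²≤n² (<⇒≱ (*-mono-< n<m n<m))

  linear-of-square-bound : ∀ P q s n K → (P * P) * n ≤ (s * s) * (q * q) → K * K ≤ n → P * K ≤ q * s
  linear-of-square-bound P q s n K bound K²≤n = m*m≤n*n⇒m≤n (P * K) (q * s) (begin
    (P * K) * (P * K) ≡⟨ regroup P K ⟩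
    (P * P) * (K * K) ≤⟨ *-monoʳ-≤ (P * P) K²≤n ⟩
    (P * P) * n       ≤⟨ bound ⟩
    (s * s) * (q * q) ≡⟨ regroup′ s q ⟩
    (q * s) * (q * s) ∎)
    where
    regroup : ∀ a b → (a * b) * (a * b) ≡ (a * a) * (b * b)
    regroup = solve-∀
    regroup′ : ∀ a b → (a * a) * (b * b) ≡ (b * a) * (b * a)
    regroup′ = solve-∀

  square≤⇒≤ : ∀ {m k n} → suc m * suc m ≤ n → n ≤ k * k + k + 1 → m ≤ k
  square≤⇒≤ {m} {k} {n} m²≤n n≤ = s≤s⁻¹ (m*m≤n*n⇒m≤n (suc m) (suc k) (begin
    suc m * suc m     ≤⟨ m²≤n ⟩
    n                 ≤⟨ n≤ ⟩
    k * k + k + 1     ≤⟨ m≤m+n _ k ⟩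
    k * k + k + 1 + k ≡⟨ expand k ⟩
    suc k * suc k     ∎))
    where
    expand : ∀ k → k * k + k + 1 + k ≡ suc k * suc k
    expand = solve-∀

  nine-tenths : ∀ {p P K s} → 9 * p < P → P * K ≤ (p + P) * s → 9 * K ≤ 10 * s
  nine-tenths {p} {P} {K} {s} 9p<P PK≤qs = *-cancelˡ-≤ (p + P) {{>-nonZero (≤-trans (s≤s z≤n) (≤-trans 9p<P (m≤n+m P p)))}} (begin
    (p + P) * (9 * K)     ≡⟨ split p P K ⟩
    (9 * p) * K + 9 * (P * K) ≤⟨ +-monoˡ-≤ _ (*-monoˡ-≤ K (<⇒≤ 9p<P)) ⟩
    P * K + 9 * (P * K)   ≡⟨ tenfold (P * K) ⟩
    10 * (P * K)          ≤⟨ *-monoʳ-≤ 10 PK≤qs ⟩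
    10 * ((p + P) * s)    ≡⟨ *-comm-left 10 (p + P) s ⟩
    (p + P) * (10 * s)    ∎)
    where
    split : ∀ p P K → (p + P) * (9 * K) ≡ (9 * p) * K + 9 * (P * K)
    split = solve-∀
    tenfold : ∀ x → x + 9 * x ≡ 10 * x
    tenfold = solve-∀
    *-comm-left : ∀ a b c → a * (b * c) ≡ b * (a * c)
    *-comm-left = solve-∀

  deficit-bound : ∀ {p P K s} → P * K ≤ (p + P) * s → (p + P) * (suc K ∸ s) ≤ p * suc K + (p + P)
  deficit-bound {p} {P} {K} {s} PK≤qs = begin
    (p + P) * (suc K ∸ s)               ≡⟨ *-distribˡ-∸ (p + P) (suc K) s ⟩
    (p + P) * suc K ∸ (p + P) * s       ≤⟨ m≤n+o⇒m∸n≤o ((p + P) * suc K) ((p + P) * s) (begin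
      (p + P) * suc K                     ≡⟨ split p P K ⟩
      P * K + (p * suc K + P)             ≤⟨ +-mono-≤ PK≤qs (+-monoʳ-≤ (p * suc K) (m≤n+m P p)) ⟩
      (p + P) * s + (p * suc K + (p + P)) ∎) ⟩
    p * suc K + (p + P)                 ∎
    where
    split : ∀ p P K → (p + P) * suc K ≡ P * K + (p * suc K + P)
    split = solve-∀

  degree-bound : ∀ {K D W t n} → 18 ≤ K → (9 * K ∸ 10) * D ≤ 10 * W → W + t ≤ t * n →
                 n ≤ suc K * suc K + suc K + 1 → 4 * D ≤ 5 * (t * suc (suc K))
  degree-bound {K} {D} {W} {t} {n} 18≤K cD≤10W W+t≤tn n≤ = *-cancelˡ-≤ c {{>-nonZero (≤-trans (s≤s z≤n) 8k≤c)}} (begin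
    c * (4 * D)                    ≡⟨ *-comm-left c 4 D ⟩
    4 * (c * D)                    ≤⟨ *-monoʳ-≤ 4 cD≤10W ⟩
    4 * (10 * W)                   ≤⟨ *-monoʳ-≤ 4 (*-monoʳ-≤ 10 W≤) ⟩
    4 * (10 * (t * (k * k + k)))   ≡⟨ factor t k ⟩
    (8 * k) * (5 * (t * suc k))    ≤⟨ *-monoˡ-≤ (5 * (t * suc k)) 8k≤c ⟩
    c * (5 * (t * suc k))          ∎)
    where
    k = suc K
    c = 9 * K ∸ 10
    8k≤c : 8 * k ≤ c
    8k≤c = m+n≤o⇒m≤o∸n (8 * k) (≤-trans (≤-reflexive (shift K)) (≤-trans (+-monoʳ-≤ (8 * K) 18≤K) (≤-reflexive (nine K))))
      where
      shift : ∀ K → 8 * suc K + 10 ≡ 8 * K + 18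
      shift = solve-∀
      nine : ∀ K → 8 * K + K ≡ 9 * K
      nine = solve-∀
    W≤ : W ≤ t * (k * k + k)
    W≤ = +-cancelʳ-≤ t W _ (≤-trans W+t≤tn (≤-trans (*-monoʳ-≤ t n≤) (≤-reflexive (*-suc′ t (k * k + k)))))
      where
      *-suc′ : ∀ t x → t * (x + 1) ≡ t * x + t
      *-suc′ = solve-∀
    *-comm-left : ∀ a b x → a * (b * x) ≡ b * (a * x)
    *-comm-left = solve-∀
    factor : ∀ t k → 4 * (10 * (t * (k * k + k))) ≡ (8 * k) * (5 * (t * suc k))
    factor = solve-∀

  C+3≤tn-of-uniform-bound : ∀ {t k n i S Y C} → 1 ≤ t → k * k + 2 ≤ n + k →
    5 * suc k * i + 4 * Y + 12 + 4 * k ≤ 4 * (k * k + 2) →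
    C ≤ S + t * Y → 4 * S ≤ 5 * (t * suc k) * i → C + 3 ≤ t * n
  C+3≤tn-of-uniform-bound {t} {k} {n} {i} {S} {Y} {C} 1≤t n-lower slack C≤ 4S≤ =
    *-cancelˡ-≤ 4 (≤-trans scaled (+-cancelʳ-≤ (t * (4 * k)) _ _ (begin
      t * X + t * (4 * k)     ≡⟨ *-distribˡ-+ t X (4 * k) ⟨
      t * (X + 4 * k)         ≤⟨ *-monoʳ-≤ t slack ⟩
      t * (4 * (k * k + 2))   ≤⟨ *-monoʳ-≤ t (*-monoʳ-≤ 4 n-lower) ⟩
      t * (4 * (n + k))       ≡⟨ spread t n k ⟩
      4 * (t * n) + t * (4 * k) ∎)))
    where
    X = 5 * suc k * i + 4 * Y + 12
    scaled : 4 * (C + 3) ≤ t * X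
    scaled = begin
      4 * (C + 3)                                     ≡⟨ *-distribˡ-+ 4 C 3 ⟩
      4 * C + 12                                      ≤⟨ +-mono-≤ (*-monoʳ-≤ 4 C≤) (*-monoʳ-≤ 12 1≤t) ⟩
      4 * (S + t * Y) + 12 * t                        ≡⟨ cong (_+ 12 * t) (*-distribˡ-+ 4 S (t * Y)) ⟩
      4 * S + 4 * (t * Y) + 12 * t                    ≤⟨ +-monoˡ-≤ (12 * t) (+-monoˡ-≤ (4 * (t * Y)) 4S≤) ⟩
      5 * (t * suc k) * i + 4 * (t * Y) + 12 * t      ≡⟨ collect t k i Y ⟩
      t * X                                           ∎
      where
      collect : ∀ t k i Y → 5 * (t * suc k) * i + 4 * (t * Y) + 12 * t ≡ t * (5 * suc k * i + 4 * Y + 12)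
      collect = solve-∀
    spread : ∀ t n k → t * (4 * (n + k)) ≡ 4 * (t * n) + t * (4 * k)
    spread = solve-∀

  -- Each polynomial inequality is reduced, by writing the variables as offsets from their lower
  -- bounds, to an identity "left side + manifestly nonnegative slack = right side".
  quadratic-slack-wide : ∀ {i a} → 2 ≤ i → 9 * i ≤ a →
    5 * suc (i + a) * i + 4 * (a * a) + 12 + 4 * (i + a) ≤ 4 * ((i + a) * (i + a) + 2)
  quadratic-slack-wide {i} {a} 2≤i 9i≤a = subst₂ Goal i≡ a≡ (polynomial (i ∸ 2) (a ∸ 9 * i))
    where
    Goal : ℕ → ℕ → Set
    Goal i a = 5 * suc (i + a) * i + 4 * (a * a) + 12 + 4 * (i + a) ≤ 4 * ((i + a) * (i + a) + 2)
    i≡ : 2 + (i ∸ 2) ≡ i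
    i≡ = m+[n∸m]≡n 2≤i
    a≡ : 9 * (2 + (i ∸ 2)) + (a ∸ 9 * i) ≡ a
    a≡ = trans (cong (λ x → 9 * x + (a ∸ 9 * i)) i≡) (m+[n∸m]≡n 9i≤a)
    polynomial : ∀ j r → Goal (2 + j) (9 * (2 + j) + r)
    polynomial j r = ≤-trans (m≤m+n _ (10 + 59 * j + 26 * (j * j) + 2 * r + 3 * (j * r))) (≤-reflexive (identity j r))
      where
      identity : ∀ j r → 5 * suc ((2 + j) + (9 * (2 + j) + r)) * (2 + j) + 4 * ((9 * (2 + j) + r) * (9 * (2 + j) + r))
                         + 12 + 4 * ((2 + j) + (9 * (2 + j) + r)) + (10 + 59 * j + 26 * (j * j) + 2 * r + 3 * (j * r))
                         ≡ 4 * (((2 + j) + (9 * (2 + j) + r)) * ((2 + j) + (9 * (2 + j) + r)) + 2)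
      identity = solve-∀

  quadratic-slack-narrow : ∀ {k} → 6 ≤ k → 5 * suc k * 1 + 4 * ((k ∸ 2) * (k ∸ 1)) + 12 + 4 * k ≤ 4 * (k * k + 2)
  quadratic-slack-narrow {k} 6≤k = subst Goal (m+[n∸m]≡n 6≤k) (polynomial (k ∸ 6))
    where
    Goal : ℕ → Set
    Goal k = 5 * suc k * 1 + 4 * ((k ∸ 2) * (k ∸ 1)) + 12 + 4 * k ≤ 4 * (k * k + 2)
    polynomial : ∀ r → Goal (6 + r)
    polynomial r = ≤-trans (m≤m+n _ (1 + 3 * r)) (≤-reflexive (identity r))
      where
      identity : ∀ r → 5 * suc (6 + r) * 1 + 4 * ((4 + r) * (5 + r)) + 12 + 4 * (6 + r) + (1 + 3 * r)
                       ≡ 4 * ((6 + r) * (6 + r) + 2)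
      identity = solve-∀

  C+3≤tn-of-wide-intersection : ∀ {t k n i a b S C} → 1 ≤ t → k * k + 2 ≤ n + k →
    2 ≤ i → 10 * i ≤ k → a + i ≤ k → b + i ≤ k →
    C ≤ S + (t * b) * a → 4 * S ≤ 5 * (t * suc k) * i → C + 3 ≤ t * n
  C+3≤tn-of-wide-intersection {t} {k} {n} {i} {a} {b} {S} {C} 1≤t n-lower 2≤i 10i≤k a+i≤k b+i≤k C≤ 4S≤ =
    C+3≤tn-of-uniform-bound 1≤t n-lower slack (≤-trans C≤ (+-monoʳ-≤ S ba≤)) 4S≤
    where
    k′ = k ∸ i
    i+k′≡k : i + k′ ≡ k
    i+k′≡k = m+[n∸m]≡n (≤-trans (m≤n*m i 10) 10i≤k)
    ≤k′ : ∀ {x} → x + i ≤ k → x ≤ k′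
    ≤k′ = m+n≤o⇒m≤o∸n _
    ba≤ : (t * b) * a ≤ t * (k′ * k′)
    ba≤ = ≤-trans (≤-reflexive (*-assoc t b a)) (*-monoʳ-≤ t (*-mono-≤ (≤k′ b+i≤k) (≤k′ a+i≤k)))
    slack : 5 * suc k * i + 4 * (k′ * k′) + 12 + 4 * k ≤ 4 * (k * k + 2)
    slack = subst (λ k → 5 * suc k * i + 4 * (k′ * k′) + 12 + 4 * k ≤ 4 * (k * k + 2)) i+k′≡k
              (quadratic-slack-wide 2≤i (+-cancelˡ-≤ i _ _ (≤-trans 10i≤k (≤-reflexive (sym i+k′≡k)))))

  C+3≤tn-of-small-edge : ∀ {t k n a b S C} → 1 ≤ t → k * k + 2 ≤ n + k → 6 ≤ k →
    a + 2 ≤ k ⊎ b + 2 ≤ k → a + 1 ≤ k → b + 1 ≤ k →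
    C ≤ S + (t * b) * a → 4 * S ≤ 5 * (t * suc k) * 1 → C + 3 ≤ t * n
  C+3≤tn-of-small-edge {t} {k} {n} {a} {b} {S} {C} 1≤t n-lower 6≤k one-small a+1≤k b+1≤k C≤ 4S≤ =
    C+3≤tn-of-uniform-bound 1≤t n-lower (quadratic-slack-narrow 6≤k) (≤-trans C≤ (+-monoʳ-≤ S ba≤)) 4S≤
    where
    ba≤ : (t * b) * a ≤ t * ((k ∸ 2) * (k ∸ 1))
    ba≤ = ≤-trans (≤-reflexive (*-assoc t b a)) (*-monoʳ-≤ t (one-small-product one-small))
      where
      one-small-product : a + 2 ≤ k ⊎ b + 2 ≤ k → b * a ≤ (k ∸ 2) * (k ∸ 1)
      one-small-product (inj₁ a+2≤k) = ≤-trans (≤-reflexive (*-comm b a)) (*-mono-≤ (m+n≤o⇒m≤o∸n a a+2≤k) (m+n≤o⇒m≤o∸n b b+1≤k))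
      one-small-product (inj₂ b+2≤k) = *-mono-≤ (m+n≤o⇒m≤o∸n b b+2≤k) (m+n≤o⇒m≤o∸n a a+1≤k)

  cubic-slack : ∀ {p q K n} → 1 ≤ p → q + 3 ≤ K → K * suc K + 2 ≤ n →
    4 * p * n + p * suc K + q + 4 * p * (K * K * K) < 4 * p * K * n + 4 * p
  cubic-slack {suc p′} {q} {K} {n} _ q+3≤K n-lower =
    subst₂ Goal (m+[n∸m]≡n q+3≤K) n≡ (polynomial (K ∸ (q + 3)) (n ∸ (K * suc K + 2)))
    where
    Goal : ℕ → ℕ → Set
    Goal K n = 4 * suc p′ * n + suc p′ * suc K + q + 4 * suc p′ * (K * K * K) < 4 * suc p′ * K * n + 4 * suc p′
    n≡ : (q + 3 + (K ∸ (q + 3))) * suc (q + 3 + (K ∸ (q + 3))) + 2 + (n ∸ (K * suc K + 2)) ≡ n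
    n≡ = trans (cong (λ K′ → K′ * suc K′ + 2 + (n ∸ (K * suc K + 2))) (m+[n∸m]≡n q+3≤K)) (m+[n∸m]≡n n-lower)
    polynomial : ∀ r z → Goal (q + 3 + r) ((q + 3 + r) * suc (q + 3 + r) + 2 + z)
    polynomial r z = ≤-trans (s≤s (m≤m+n _ (q * (2 + 3 * p′) + 3 + 4 * p′ + 3 * suc p′ * r + 4 * suc p′ * (q + 2 + r) * z)))
                                  (≤-reflexive (identity p′ q r z))
      where
      identity : ∀ p′ q r z → let K = q + 3 + r ; n = K * suc K + 2 + z in
        suc (4 * suc p′ * n + suc p′ * suc K + q + 4 * suc p′ * (K * K * K)
             + (q * (2 + 3 * p′) + 3 + 4 * p′ + 3 * suc p′ * r + 4 * suc p′ * (q + 2 + r) * z))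
        ≡ 4 * suc p′ * K * n + 4 * suc p′
      identity = solve-∀

  deficit-sum-bound : ∀ {p q t F M S} .{{_ : NonZero q}} → q * F ≤ M * S → 4 * p * S ≤ t * q → 4 * p * F ≤ M * t
  deficit-sum-bound {p} {q} {t} {F} {M} {S} qF≤MS 4pS≤tq = *-cancelˡ-≤ q (begin
    q * (4 * p * F)   ≡⟨ e₁ q p F ⟩
    4 * p * (q * F)   ≤⟨ *-monoʳ-≤ (4 * p) qF≤MS ⟩
    4 * p * (M * S)   ≡⟨ e₂ p M S ⟩
    M * (4 * p * S)   ≤⟨ *-monoʳ-≤ M 4pS≤tq ⟩
    M * (t * q)       ≡⟨ e₃ M t q ⟩
    q * (M * t)       ∎)
    where
    e₁ : ∀ q p F → q * (4 * p * F) ≡ 4 * p * (q * F)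
    e₁ = solve-∀
    e₂ : ∀ p M S → 4 * p * (M * S) ≡ M * (4 * p * S)
    e₂ = solve-∀
    e₃ : ∀ M t q → M * (t * q) ≡ q * (M * t)
    e₃ = solve-∀

  C+3≤tn-of-small-deficit : ∀ {t K n p q C D W F S} .{{_ : NonZero q}} → 1 ≤ t → 1 ≤ p → q + 3 ≤ K → K * suc K + 2 ≤ n →
    C ≤ D + t * (K * K) → K * (2 + D) ≤ W + F → W + t ≤ t * n →
    q * F ≤ (p * suc K + q) * S → 4 * p * S ≤ t * q → C + 3 ≤ t * n
  C+3≤tn-of-small-deficit {t} {K} {n} {p} {q} {C} {D} {W} {F} {S} 1≤t 1≤p q+3≤K n-lower C≤ K[2+D]≤ W+t≤tn qF≤ 4pS≤ = begin
    C + 3                     ≤⟨ +-monoˡ-≤ 3 C≤ ⟩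
    D + t * (K * K) + 3       ≡⟨ regroup D t K ⟩
    suc G                     ≤⟨ G<tn ⟩
    t * n                     ∎
    where
    M = p * suc K + q
    G = D + 2 + t * (K * K)
    scaled : 4 * p * K * G + 4 * p * t ≤ t * (4 * p * n + p * suc K + q + 4 * p * (K * K * K))
    scaled = begin
      4 * p * K * G + 4 * p * t                                         ≡⟨ e₄ p K D t ⟩
      4 * p * (K * (2 + D)) + 4 * p * t + t * (4 * p * (K * K * K))     ≤⟨ +-monoˡ-≤ _ (+-monoˡ-≤ _ (*-monoʳ-≤ (4 * p) K[2+D]≤)) ⟩
      4 * p * (W + F) + 4 * p * t + t * (4 * p * (K * K * K))           ≡⟨ e₅ p W F t K ⟩
      4 * p * (W + t) + 4 * p * F + t * (4 * p * (K * K * K))           ≤⟨ +-monoˡ-≤ _ (+-mono-≤ (*-monoʳ-≤ (4 * p) W+t≤tn) 4pF≤Mt) ⟩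
      4 * p * (t * n) + M * t + t * (4 * p * (K * K * K))               ≡⟨ e₆ p t n K q ⟩
      t * (4 * p * n + p * suc K + q + 4 * p * (K * K * K))             ∎
      where
      4pF≤Mt : 4 * p * F ≤ M * t
      4pF≤Mt = deficit-sum-bound {p} {q} {t} {F} {M} {S} qF≤ 4pS≤
      e₄ : ∀ p K D t → 4 * p * K * (D + 2 + t * (K * K)) + 4 * p * t ≡ 4 * p * (K * (2 + D)) + 4 * p * t + t * (4 * p * (K * K * K))
      e₄ = solve-∀
      e₅ : ∀ p W F t K → 4 * p * (W + F) + 4 * p * t + t * (4 * p * (K * K * K)) ≡ 4 * p * (W + t) + 4 * p * F + t * (4 * p * (K * K * K))
      e₅ = solve-∀
      e₆ : ∀ p t n K q → 4 * p * (t * n) + (p * suc K + q) * t + t * (4 * p * (K * K * K)) ≡ t * (4 * p * n + p * suc K + q + 4 * p * (K * K * K))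
      e₆ = solve-∀
    G<tn : G < t * n
    G<tn = *-cancelˡ-< (4 * p * K) G (t * n) (+-cancelʳ-< (4 * p * t) _ _ (begin-strict
      4 * p * K * G + 4 * p * t                           ≤⟨ scaled ⟩
      t * (4 * p * n + p * suc K + q + 4 * p * (K * K * K)) <⟨ *-monoʳ-< t {{>-nonZero 1≤t}} (cubic-slack 1≤p q+3≤K n-lower) ⟩
      t * (4 * p * K * n + 4 * p)                         ≡⟨ e₇ t p K n ⟩
      4 * p * K * (t * n) + 4 * p * t                     ∎))
      where
      e₇ : ∀ t p K n → t * (4 * p * K * n + 4 * p) ≡ 4 * p * K * (t * n) + 4 * p * t
      e₇ = solve-∀
    regroup : ∀ D t K → D + t * (K * K) + 3 ≡ suc (D + 2 + t * (K * K))
    regroup = solve-∀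

module Rationals where

  open import Data.Empty using (⊥-elim)
  open import Data.Integer.Base as ℤ using (+_; +[1+_]; -[1+_]; +<+)
  import Data.Integer.Properties as ℤ
  open import Data.Nat.Base as ℕ using (ℕ; zero; suc; z≤n; s≤s)
  import Data.Nat.Properties as ℕ
  open import Data.Nat.Coprimality using (Coprime; 1-coprimeTo) renaming (sym to coprime-sym)
  open import Data.Rational.Base as ℚ using (ℚ; mkℚ; 0ℚ; 1ℚ; _-_; toℚᵘ)
  open import Data.Rational.Properties using (normalize-coprime; toℚᵘ-mono-≤; toℚᵘ-homo-+; toℚᵘ-homo‿-; toℚᵘ-homo-*)
  open import Data.Rational.Unnormalised.Base as ℚᵘ using (mkℚᵘ; *≤*; _≃_)
  import Data.Rational.Unnormalised.Properties as ℚᵘ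
  open import Data.Sum.Base using (inj₁; inj₂)
  open import Relation.Binary.PropositionalEquality

  ⅒ : ℚ
  ⅒ = mkℚ (+ 1) 9 (1-coprimeTo 10)

  0<⅒ : 0ℚ ℚ.< ⅒
  0<⅒ = ℚ.*<* (+<+ (s≤s z≤n))

  toℚᵘ-⟦⟧ : ∀ n → toℚᵘ ⟦ n ⟧ ≃ mkℚᵘ (+ n) 0
  toℚᵘ-⟦⟧ n = ℚᵘ.≃-reflexive (cong toℚᵘ (normalize-coprime (coprime-sym (1-coprimeTo n))))

  toℚᵘ-≤ : ∀ {p q x y} → p ℚ.≤ q → toℚᵘ p ≃ x → toℚᵘ q ≃ y → x ℚᵘ.≤ y
  toℚᵘ-≤ p≤q p≃x q≃y = ℚᵘ.≤-respʳ-≃ q≃y (ℚᵘ.≤-respˡ-≃ p≃x (toℚᵘ-mono-≤ p≤q))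

  cross-≤ : ∀ {a b c d} → mkℚᵘ a b ℚᵘ.≤ mkℚᵘ c d → a ℤ.* + suc d ℤ.≤ c ℤ.* + suc b
  cross-≤ (*≤* ad≤cb) = ad≤cb

  below-⅒ : ∀ {a d} .{c : Coprime (suc a) (suc d)} → mkℚ +[1+ a ] d c ℚ.< ⅒ → 10 ℕ.* suc a ℕ.< suc d
  below-⅒ {a} {d} (ℚ.*<* a10<d) =
    subst (ℕ._< suc d) (ℕ.*-comm (suc a) 10) (ℤ.drop‿+<+ (subst₂ ℤ._<_ (sym (ℤ.pos-* (suc a) 10)) (ℤ.*-identityˡ (+ suc d)) a10<d))

  α-bound : ∀ {α i k} → 0ℚ ℚ.< α → α ℚ.< ⅒ → ⟦ i ⟧ ℚ.≤ α ℚ.* ⟦ k ⟧ → 10 ℕ.* i ℕ.≤ k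
  α-bound {mkℚ (+ zero)   _ _} (ℚ.*<* (+<+ ()))
  α-bound {mkℚ -[1+ _ ]   _ _} (ℚ.*<* ())
  α-bound {α@(mkℚ +[1+ a ] d _)} {i} {k} _ α<⅒ i≤αk = ℕ.*-cancelˡ-≤ (suc d) (begin
    suc d ℕ.* (10 ℕ.* i)   ≡⟨ ℕ.*-comm (suc d) (10 ℕ.* i) ⟩
    10 ℕ.* i ℕ.* suc d     ≡⟨ ℕ.*-assoc 10 i (suc d) ⟩
    10 ℕ.* (i ℕ.* suc d)   ≤⟨ ℕ.*-monoʳ-≤ 10 iq≤ak ⟩
    10 ℕ.* (suc a ℕ.* k)   ≡⟨ ℕ.*-assoc 10 (suc a) k ⟨
    10 ℕ.* suc a ℕ.* k     ≤⟨ ℕ.*-monoˡ-≤ k (ℕ.<⇒≤ (below-⅒ α<⅒)) ⟩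
    suc d ℕ.* k            ∎)
    where
    open ℕ.≤-Reasoning
    rhs≃ : toℚᵘ (α ℚ.* ⟦ k ⟧) ≃ toℚᵘ α ℚᵘ.* mkℚᵘ (+ k) 0
    rhs≃ = ℚᵘ.≃-trans (toℚᵘ-homo-* α ⟦ k ⟧) (ℚᵘ.*-cong (ℚᵘ.≃-refl {toℚᵘ α}) (toℚᵘ-⟦⟧ k))
    iq≤ak : i ℕ.* suc d ℕ.≤ suc a ℕ.* k
    iq≤ak = ℤ.drop‿+≤+ (subst₂ ℤ._≤_ (trans (cong (λ x → + i ℤ.* + suc x) (ℕ.*-identityʳ d)) (sym (ℤ.pos-* i (suc d))))
                                      (trans (ℤ.*-identityʳ _) (sym (ℤ.pos-* (suc a) k)))
              (cross-≤ (toℚᵘ-≤ i≤αk (toℚᵘ-⟦⟧ i) rhs≃)))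

  -- δ = p / (p + P), so that 1 − δ = P / (p + P) and δ < 1/10 says 9p < P.
  record SmallFraction (δ : ℚ) : Set where
    field
      p P          : ℕ
      1≤p          : 1 ℕ.≤ p
      9p<P         : 9 ℕ.* p ℕ.< P
      sqrt-bound   : ∀ {n s} → AtLeastSqrtBound δ n s → (P ℕ.* P) ℕ.* n ℕ.≤ (s ℕ.* s) ℕ.* ((p ℕ.+ P) ℕ.* (p ℕ.+ P))
      small-degree : ∀ {S t} → (⟦ 4 ⟧ ℚ.* δ) ℚ.* ⟦ S ⟧ ℚ.≤ ⟦ t ⟧ → 4 ℕ.* p ℕ.* S ℕ.≤ t ℕ.* (p ℕ.+ P)

  module _ (p₀ P : ℕ) .(c : Coprime (suc p₀) (suc (p₀ ℕ.+ P))) where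

    private
      δ : ℚ
      δ = mkℚ +[1+ p₀ ] (p₀ ℕ.+ P) c
      q = suc (p₀ ℕ.+ P)

    toℚᵘ-1-δ : toℚᵘ (1ℚ - δ) ≃ mkℚᵘ (+ P) (p₀ ℕ.+ P)
    toℚᵘ-1-δ = ℚᵘ.≃-trans (toℚᵘ-homo-+ 1ℚ (ℚ.- δ)) (ℚᵘ.≃-trans (ℚᵘ.+-cong (ℚᵘ.≃-refl {toℚᵘ 1ℚ}) (toℚᵘ-homo‿- δ)) (ℚᵘ.*≡* cross))
      where
      numerator : + 1 ℤ.* + q ℤ.+ -[1+ p₀ ] ℤ.* + 1 ≡ + P
      numerator = begin
        + 1 ℤ.* + q ℤ.+ -[1+ p₀ ] ℤ.* + 1  ≡⟨ cong₂ ℤ._+_ (ℤ.*-identityˡ (+ q)) (ℤ.*-identityʳ -[1+ p₀ ]) ⟩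
        q ℤ.⊖ suc p₀                       ≡⟨ ℤ.[1+m]⊖[1+n]≡m⊖n (p₀ ℕ.+ P) p₀ ⟩
        (p₀ ℕ.+ P) ℤ.⊖ p₀                  ≡⟨ ℤ.⊖-≥ (ℕ.m≤m+n p₀ P) ⟩
        + (p₀ ℕ.+ P ℕ.∸ p₀)                ≡⟨ cong +_ (ℕ.m+n∸m≡n p₀ P) ⟩
        + P                                ∎
        where open ≡-Reasoning
      cross : (+ 1 ℤ.* + q ℤ.+ -[1+ p₀ ] ℤ.* + 1) ℤ.* + q ≡ + P ℤ.* + suc (p₀ ℕ.+ P ℕ.+ 0)
      cross = cong₂ ℤ._*_ numerator (cong (λ x → + suc x) (sym (ℕ.+-identityʳ (p₀ ℕ.+ P))))

    1-δ≰0 : 1 ℕ.≤ P → (1ℚ - δ) ℚ.≰ 0ℚ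
    1-δ≰0 1≤P 1-δ≤0 = ℕ.<⇒≱ 1≤P (ℤ.drop‿+≤+ (subst (ℤ._≤ + 0) (ℤ.*-identityʳ (+ P))
                        (cross-≤ (toℚᵘ-≤ 1-δ≤0 toℚᵘ-1-δ (ℚᵘ.≃-refl {toℚᵘ 0ℚ})))))

    δ-sqrt-bound : 1 ℕ.≤ P → ∀ {n s} → AtLeastSqrtBound δ n s → (P ℕ.* P) ℕ.* n ℕ.≤ (s ℕ.* s) ℕ.* (q ℕ.* q)
    δ-sqrt-bound 1≤P (inj₁ 1-δ≤0) = ⊥-elim (1-δ≰0 1≤P 1-δ≤0)
    δ-sqrt-bound _ {n} {s} (inj₂ bound) = ℤ.drop‿+≤+ (subst₂ ℤ._≤_ lhs rhs (cross-≤ (toℚᵘ-≤ bound lhs≃ rhs≃)))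
      where
      lhs≃ : toℚᵘ (((1ℚ - δ) ℚ.* (1ℚ - δ)) ℚ.* ⟦ n ⟧) ≃ (mkℚᵘ (+ P) (p₀ ℕ.+ P) ℚᵘ.* mkℚᵘ (+ P) (p₀ ℕ.+ P)) ℚᵘ.* mkℚᵘ (+ n) 0
      lhs≃ = ℚᵘ.≃-trans (toℚᵘ-homo-* ((1ℚ - δ) ℚ.* (1ℚ - δ)) ⟦ n ⟧)
               (ℚᵘ.*-cong (ℚᵘ.≃-trans (toℚᵘ-homo-* (1ℚ - δ) (1ℚ - δ)) (ℚᵘ.*-cong toℚᵘ-1-δ toℚᵘ-1-δ)) (toℚᵘ-⟦⟧ n))
      rhs≃ : toℚᵘ (⟦ s ⟧ ℚ.* ⟦ s ⟧) ≃ mkℚᵘ (+ s) 0 ℚᵘ.* mkℚᵘ (+ s) 0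
      rhs≃ = ℚᵘ.≃-trans (toℚᵘ-homo-* ⟦ s ⟧ ⟦ s ⟧) (ℚᵘ.*-cong (toℚᵘ-⟦⟧ s) (toℚᵘ-⟦⟧ s))
      lhs : ((+ P ℤ.* + P) ℤ.* + n) ℤ.* + 1 ≡ + (P ℕ.* P ℕ.* n)
      lhs = trans (ℤ.*-identityʳ _) (trans (cong (ℤ._* + n) (sym (ℤ.pos-* P P))) (sym (ℤ.pos-* (P ℕ.* P) n)))
      rhs : (+ s ℤ.* + s) ℤ.* + suc ((p₀ ℕ.+ P ℕ.+ (p₀ ℕ.+ P) ℕ.* q) ℕ.* 1) ≡ + (s ℕ.* s ℕ.* (q ℕ.* q))
      rhs = trans (cong₂ ℤ._*_ (sym (ℤ.pos-* s s)) (cong (λ x → + suc x) (ℕ.*-identityʳ _))) (sym (ℤ.pos-* (s ℕ.* s) (q ℕ.* q)))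

    δ-small-degree : ∀ {S t} → (⟦ 4 ⟧ ℚ.* δ) ℚ.* ⟦ S ⟧ ℚ.≤ ⟦ t ⟧ → 4 ℕ.* suc p₀ ℕ.* S ℕ.≤ t ℕ.* q
    δ-small-degree {S} {t} bound = ℤ.drop‿+≤+ (subst₂ ℤ._≤_ lhs rhs (cross-≤ (toℚᵘ-≤ bound lhs≃ (toℚᵘ-⟦⟧ t))))
      where
      lhs≃ : toℚᵘ ((⟦ 4 ⟧ ℚ.* δ) ℚ.* ⟦ S ⟧) ≃ (mkℚᵘ (+ 4) 0 ℚᵘ.* toℚᵘ δ) ℚᵘ.* mkℚᵘ (+ S) 0
      lhs≃ = ℚᵘ.≃-trans (toℚᵘ-homo-* (⟦ 4 ⟧ ℚ.* δ) ⟦ S ⟧)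
               (ℚᵘ.*-cong (ℚᵘ.≃-trans (toℚᵘ-homo-* ⟦ 4 ⟧ δ) (ℚᵘ.*-cong (toℚᵘ-⟦⟧ 4) (ℚᵘ.≃-refl {toℚᵘ δ}))) (toℚᵘ-⟦⟧ S))
      lhs : ((+ 4 ℤ.* + suc p₀) ℤ.* + S) ℤ.* + 1 ≡ + (4 ℕ.* suc p₀ ℕ.* S)
      lhs = trans (ℤ.*-identityʳ _) (trans (cong (ℤ._* + S) (sym (ℤ.pos-* 4 (suc p₀)))) (sym (ℤ.pos-* (4 ℕ.* suc p₀) S)))
      rhs : + t ℤ.* + suc ((p₀ ℕ.+ P ℕ.+ 0) ℕ.* 1) ≡ + (t ℕ.* q)
      rhs = trans (cong (λ x → + t ℤ.* + suc x) (trans (ℕ.*-identityʳ _) (ℕ.+-identityʳ _))) (sym (ℤ.pos-* t q))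

  small-fraction : ∀ {δ} → 0ℚ ℚ.< δ → δ ℚ.< ⅒ → SmallFraction δ
  small-fraction {mkℚ (+ zero)   _ _} (ℚ.*<* (+<+ ()))
  small-fraction {mkℚ -[1+ _ ]   _ _} (ℚ.*<* ())
  small-fraction {mkℚ +[1+ p₀ ] d c} _ δ<⅒
    with ℕ.m≤n⇒∃[o]m+o≡n (ℕ.≤-trans (ℕ.m≤m+n p₀ _) (ℕ.<⇒≤ (ℕ.s≤s⁻¹ (below-⅒ δ<⅒))))
  ... | P , refl = record
    { p            = suc p₀
    ; P            = P
    ; 1≤p          = s≤s z≤n
    ; 9p<P         = 9p<P
    ; sqrt-bound   = λ {n} {s} → δ-sqrt-bound p₀ P c (ℕ.≤-trans (s≤s z≤n) 9p<P) {n} {s}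
    ; small-degree = λ {S} {t} → δ-small-degree p₀ P c {S} {t}
    }
    where
    9p<P : 9 ℕ.* suc p₀ ℕ.< P
    9p<P = ℕ.+-cancelˡ-≤ p₀ _ _ (subst (ℕ._≤ p₀ ℕ.+ P) (sym (ℕ.+-suc p₀ (9 ℕ.* suc p₀))) (ℕ.s≤s⁻¹ (below-⅒ δ<⅒)))

module UsefulPairs where

  open Counting
  open HypergraphCounting
  open Inequalities
  open import Data.Bool.Base using (true; if_then_else_)
  open import Data.Fin.Base using (Fin)
  open import Data.Fin.Subset using (_∈_; _∩_; Nonempty; ∣_∣)
  open import Data.Fin.Subset.Properties using (_∈?_)
  open import Data.Nat.Base using (ℕ; suc; _+_; _*_; _∸_; _≤_; _<_; z≤n; s≤s; s≤s⁻¹; >-nonZero)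
  open import Data.Nat.Properties
  open import Algebra.Properties.Semiring.Sum +-*-semiring using (sum-syntax)
  open import Data.Product.Base using (∃-syntax; _,_; _×_)
  open import Data.Sum.Base as Sum using (_⊎_; inj₁; inj₂)
  open import Relation.Binary.PropositionalEquality
  open import Relation.Nullary.Decidable using (Dec; yes; no)
  open import Relation.Nullary.Negation using (¬_; contradiction)

  -- Edges have at most k = K + 1 vertices, and edges-large says (1 − δ)(k − 1) ≤ |g| for δ = p / (p + P).
  module _ {n t K p P : ℕ} (H : Hypergraph n) (cod : CodegreeAtMost H t)
           (1≤p : 1 ≤ p) (9p<P : 9 * p < P) (K-large : p + P + 7 ≤ K)
           (n-lower : K * suc K + 2 ≤ n) (n-upper : n ≤ suc K * suc K + suc K + 1)
           (edges-large : ∀ g → P * K ≤ (p + P) * size H g) where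

    open Hypergraph H

    private
      k q : ℕ
      k = suc K
      q = p + P

    q+3≤K : q + 3 ≤ K
    q+3≤K = ≤-trans (+-monoʳ-≤ q (s≤s (s≤s (s≤s z≤n)))) K-large

    18≤K : 18 ≤ K
    18≤K = ≤-trans (+-monoˡ-≤ 7 (+-mono-≤ 1≤p (≤-trans (s≤s (*-monoʳ-≤ 9 1≤p)) 9p<P))) K-large

    size-lower : ∀ g → 9 * K ≤ 10 * size H g
    size-lower g = nine-tenths {p} {P} {K} {size H g} 9p<P (edges-large g)

    2≤size : ∀ g → 2 ≤ size H g
    2≤size g = *-cancelˡ-≤ 10 (≤-trans (m≤m+n 20 7) (≤-trans (*-monoʳ-≤ 9 (≤-trans (m≤m+n 3 15) 18≤K)) (size-lower g)))

    4*degree≤ : ∀ y → 4 * degree H y ≤ 5 * (t * suc k)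
    4*degree≤ y = degree-bound {K} {degree H y} {pairsThrough H y} {t} {n} 18≤K
      (*-degree≤*-pairsThrough H (9 * K ∸ 10) 10 y (λ g _ → pred-size-lower g)) (pairsThrough+t≤t*n H cod y) n-upper
      where
      pred-size-lower : ∀ g → 9 * K ∸ 10 ≤ 10 * (size H g ∸ 1)
      pred-size-lower g = ≤-trans (∸-monoˡ-≤ 10 (size-lower g)) (≤-reflexive (sym (*-distribˡ-∸ 10 (size H g) 1)))

    module _ {e f : Fin m} (e≢f : e ≢ f) (size-e : size H e ≤ k) (size-f : size H f ≤ k) where

      private
        i a b C : ℕ
        i = count (inBoth H e f)
        a = count (inE∖F H e f)
        b = count (inF∖E H e f)
        C = commonNbhdSize H e f
        S∩ : ℕ
        S∩ = ∑[ y < n ] (if inBoth H e f y then otherEdgesAt H e f y else 0)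

      1≤t : 1 ≤ t
      1≤t with nonempty e
      ... | y , y∈e = codegree-positive H cod (⌊⌋-true (y ∈? V e) y∈e) (2≤size e)

      C≤ : C ≤ S∩ + (t * b) * a
      C≤ = commonNbhdSize≤ H e f cod

      4*S∩≤ : 4 * S∩ ≤ 5 * (t * suc k) * i
      4*S∩≤ = ≤-trans (≤-reflexive (*-∑-if 4 (inBoth H e f) (otherEdgesAt H e f)))
                      (∑≤*-count _ _ (λ y _ → ≤-trans (*-monoʳ-≤ 4 (otherEdgesAt≤degree H e f y)) (4*degree≤ y)))

      a+i≤k : a + i ≤ k
      a+i≤k = subst (_≤ k) (size≡inE∖F+inBoth H e f) size-e

      b+i≤k : b + i ≤ k
      b+i≤k = subst (_≤ k) (size≡inF∖E+inBoth H e f) size-f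

      n-lower′ : k * k + 2 ≤ n + k
      n-lower′ = ≤-trans (≤-reflexive (+-assoc k (K * k) 2)) (≤-trans (+-monoʳ-≤ k n-lower) (≤-reflexive (+-comm k n)))

      wide : 2 ≤ i → 10 * i ≤ k → C + 3 ≤ t * n
      wide 2≤i 10i≤k = C+3≤tn-of-wide-intersection 1≤t n-lower′ 2≤i 10i≤k a+i≤k b+i≤k C≤ 4*S∩≤

      narrow-small-edge : i ≡ 1 → size H e < k ⊎ size H f < k → C + 3 ≤ t * n
      narrow-small-edge i≡1 small = C+3≤tn-of-small-edge 1≤t n-lower′ (s≤s (≤-trans (m≤m+n 5 13) 18≤K))
        (Sum.map (+2≤ (size≡inE∖F+inBoth H e f)) (+2≤ (size≡inF∖E+inBoth H e f)) small)
        (subst (λ j → a + j ≤ k) i≡1 a+i≤k) (subst (λ j → b + j ≤ k) i≡1 b+i≤k)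
        C≤ (subst (λ j → 4 * S∩ ≤ 5 * (t * suc k) * j) i≡1 4*S∩≤)
        where
        +2≤ : ∀ {x s} → s ≡ x + i → s < k → x + 2 ≤ k
        +2≤ {x} s≡ s<k = subst (_≤ k) (trans (cong suc (trans s≡ (cong (x +_) i≡1))) (sym (+-suc x 1))) s<k

      narrow-full-edges : i ≡ 1 → size H e ≡ k → size H f ≡ k → ∀ {v} → inBoth H e f v ≡ true →
                            4 * p * smallEdgesAt H k v ≤ t * q → C + 3 ≤ t * n
      narrow-full-edges i≡1 e≡k f≡k {v} v∈e∩f small-degree =
        C+3≤tn-of-small-deficit {{>-nonZero (≤-trans 1≤p (m≤m+n p P))}} 1≤t 1≤p q+3≤K n-lower
          C≤D+tK² K[2+D]≤W+F (pairsThrough+t≤t*n H cod v) qF≤MS small-degree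
        where
        D = otherEdgesAt H e f v
        ≡K : ∀ {x s} → s ≡ x + i → s ≡ k → x ≡ K
        ≡K {x} s≡ s≡k = suc-injective (trans (trans (sym (+-comm x 1)) (trans (cong (x +_) (sym i≡1)) (sym s≡))) s≡k)
        only-v : ∀ y → inBoth H e f y ≡ true → y ≡ v
        only-v y y∈e∩f = unique-of-count≤1 (inBoth H e f) (≤-reflexive i≡1) v∈e∩f y∈e∩f
        C≤D+tK² : C ≤ D + t * (K * K)
        C≤D+tK² = ≤-trans C≤ (+-mono-≤ (∑≤-single-support (otherEdgesAt H e f) v only-v) (≤-reflexive tba≡tKK))
          where
          tba≡tKK : (t * b) * a ≡ t * (K * K)
          tba≡tKK = trans (cong₂ (λ x y → (t * x) * y) (≡K (size≡inF∖E+inBoth H e f) f≡k) (≡K (size≡inE∖F+inBoth H e f) e≡k))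
                          (*-assoc t K K)
        K[2+D]≤W+F : K * (2 + D) ≤ pairsThrough H v + deficitAt H k v
        K[2+D]≤W+F = subst (λ x → K * x ≤ pairsThrough H v + deficitAt H k v)
                       (degree≡2+otherEdgesAt H e f e≢f v∈e∩f) (*-degree≤pairsThrough+deficitAt H K v)
        qF≤MS : q * deficitAt H k v ≤ (p * k + q) * smallEdgesAt H k v
        qF≤MS = *-deficitAt≤*-smallEdgesAt H {q} {p * k + q} k v (λ g → deficit-bound {p} {P} {K} {size H g} (edges-large g))

      narrow : i ≡ 1 → (size H e < k ⊎ size H f < k)
                 ⊎ (∃[ v ] inBoth H e f v ≡ true × 4 * p * smallEdgesAt H k v ≤ t * q) → C + 3 ≤ t * n
      narrow i≡1 (inj₁ small-edge) = narrow-small-edge i≡1 small-edge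
      narrow i≡1 (inj₂ (v , v∈e∩f , small-degree)) with size H e <? k | size H f <? k
      ... | yes e<k | _       = narrow-small-edge i≡1 (inj₁ e<k)
      ... | no  _   | yes f<k = narrow-small-edge i≡1 (inj₂ f<k)
      ... | no  e≮k | no  f≮k =
        narrow-full-edges i≡1 (≤-antisym size-e (≮⇒≥ e≮k)) (≤-antisym size-f (≮⇒≥ f≮k)) v∈e∩f small-degree

    Condition : Fin m → Fin m → Set
    Condition e f = (size H e < k ⊎ size H f < k) ⊎ 2 ≤ ∣ V e ∩ V f ∣
                      ⊎ (∃[ v ] v ∈ V e ∩ V f × 4 * p * smallEdgesAt H k v ≤ t * q)

    useful : ∀ {e f} → e ≢ f → size H e ≤ k → size H f ≤ k → Nonempty (V e ∩ V f) →
             10 * ∣ V e ∩ V f ∣ ≤ k → Condition e f → Useful H t e f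
    useful {e} {f} e≢f size-e size-f (x , x∈e∩f) 10∣∩∣≤k cases = e≢f , (x , x∈e∩f) , C+3≤tn (2 ≤? i) cases
      where
      i = count (inBoth H e f)
      ∣∩∣≡i : ∣ V e ∩ V f ∣ ≡ i
      ∣∩∣≡i = ∣V∩V∣≡count-inBoth H e f
      inBoth-of-∈ : ∀ {v} → v ∈ V e ∩ V f → inBoth H e f v ≡ true
      inBoth-of-∈ {v} v∈e∩f = trans (sym (∈ᵇ-∩ v (V e) (V f))) (⌊⌋-true (v ∈? V e ∩ V f) v∈e∩f)
      i≡1 : ¬ 2 ≤ i → i ≡ 1
      i≡1 2≰i = ≤-antisym (s≤s⁻¹ (≰⇒> 2≰i)) (witness⇒1≤count _ x (inBoth-of-∈ x∈e∩f))
      C+3≤tn : Dec (2 ≤ i) → Condition e f → commonNbhdSize H e f + 3 ≤ t * n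
      C+3≤tn (yes 2≤i) _ = wide e≢f size-e size-f 2≤i (subst (λ j → 10 * j ≤ k) ∣∩∣≡i 10∣∩∣≤k)
      C+3≤tn (no  2≰i) (inj₁ small-edge) = narrow e≢f size-e size-f (i≡1 2≰i) (inj₁ small-edge)
      C+3≤tn (no  2≰i) (inj₂ (inj₁ 2≤∣∩∣)) = contradiction (subst (2 ≤_) ∣∩∣≡i 2≤∣∩∣) 2≰i
      C+3≤tn (no  2≰i) (inj₂ (inj₂ (v , v∈e∩f , small-degree))) =
        narrow e≢f size-e size-f (i≡1 2≰i) (inj₂ (v , inBoth-of-∈ v∈e∩f , small-degree))

open Inequalities using (square≤⇒≤; linear-of-square-bound)
open Rationals
open UsefulPairs using (useful)
open import Relation.Nullary.Negation using (contradiction)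
open import Data.Nat using (zero; suc; s≤s⁻¹)
open import Data.Nat.Properties using (m+n∸m≡n; ≤-trans; *-monoʳ-≤; n≤1+n; m≤m+n; m≤n+m; +-suc)
import Data.Sum as Sum
open import Relation.Binary.PropositionalEquality using (subst)

UsefulBeyond : ℚ → ℚ → ℕ → Set
UsefulBeyond α δ n₀ =
      ∀ (t k n : ℕ) → n ≥ n₀ → (k * k ∸ k) + 2 ≤ n → n ≤ k * k + k + 1 →
      (H : Hypergraph n) →
      CodegreeAtMost H t →
      (∀ g → AtLeastSqrtBound δ n (size H g)) →
      (e f : Fin (Hypergraph.m H)) → e ≢ f →
      size H e ≤ k → size H f ≤ k →
      Nonempty (Hypergraph.V H e ∩ Hypergraph.V H f) →
      ⟦ ∣ Hypergraph.V H e ∩ Hypergraph.V H f ∣ ⟧ ℚ.≤ α ℚ.* ⟦ k ⟧ →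
      ((size H e < k ⊎ size H f < k)
        ⊎ (2 ≤ ∣ Hypergraph.V H e ∩ Hypergraph.V H f ∣)
        ⊎ (Σ (Fin n) λ v → v ∈ (Hypergraph.V H e ∩ Hypergraph.V H f) ×
             (⟦ 4 ⟧ ℚ.* δ) ℚ.* ⟦ smallEdgesAt H k v ⟧ ℚ.≤ ⟦ t ⟧)) →
      Useful H t e f

useful-for-small-parameters : ∀ {α δ} → 0ℚ ℚ.< α → α ℚ.< ⅒ → 0ℚ ℚ.< δ → δ ℚ.< ⅒ → Σ ℕ (UsefulBeyond α δ)
useful-for-small-parameters {α} {δ} 0<α α<⅒ 0<δ δ<⅒ = suc Q * suc Q , usefulBeyond
  where
  open SmallFraction (small-fraction 0<δ δ<⅒)
  Q = p + P + 8
  usefulBeyond : UsefulBeyond α δ (suc Q * suc Q)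
  usefulBeyond t zero n n₀≤n _ n≤1 = contradiction (≤-trans (m≤n+m 8 (p + P)) (square≤⇒≤ {Q} {0} n₀≤n n≤1)) λ ()
  usefulBeyond t (suc K) n n₀≤n k-lower n-upper H cod sizes e f e≢f size-e size-f e∩f ∣e∩f∣≤αk cases =
    useful H cod 1≤p 9p<P K-large n-lower n-upper edges-large e≢f size-e size-f e∩f
      (α-bound {α} {∣ Hypergraph.V H e ∩ Hypergraph.V H f ∣} {suc K} 0<α α<⅒ ∣e∩f∣≤αk)
      (Sum.map₂ (Sum.map₂ λ { (v , v∈e∩f , bound) → v , v∈e∩f , small-degree {smallEdgesAt H (suc K) v} {t} bound }) cases)
    where
    K-large : p + P + 7 ≤ K
    K-large = s≤s⁻¹ (subst (_≤ suc K) (+-suc (p + P) 7) (square≤⇒≤ {Q} {suc K} n₀≤n n-upper))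
    n-lower : K * suc K + 2 ≤ n
    n-lower = subst (λ x → x + 2 ≤ n) (m+n∸m≡n (suc K) (K * suc K)) k-lower
    edges-large : ∀ g → P * K ≤ (p + P) * size H g
    edges-large g = linear-of-square-bound P (p + P) (size H g) n K (sqrt-bound {n} {size H g} (sizes g))
                      (≤-trans (*-monoʳ-≤ K (n≤1+n K)) (≤-trans (m≤m+n (K * suc K) 2) n-lower))

proposition4p6 :
    Σ ℚ λ α₀ → 0ℚ ℚ.< α₀ ×
    (∀ (α : ℚ) → 0ℚ ℚ.< α → α ℚ.< α₀ →
     Σ ℚ λ δ₀ → 0ℚ ℚ.< δ₀ ×
     (∀ (δ : ℚ) → 0ℚ ℚ.< δ → δ ℚ.< δ₀ →
      Σ ℕ λ n₀ →
      ∀ (t k n : ℕ) → n ≥ n₀ → (k * k ∸ k) + 2 ≤ n → n ≤ k * k + k + 1 →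
      (H : Hypergraph n) →
      CodegreeAtMost H t →
      (∀ g → AtLeastSqrtBound δ n (size H g)) →
      (e f : Fin (Hypergraph.m H)) → e ≢ f →
      size H e ≤ k → size H f ≤ k →
      Nonempty (Hypergraph.V H e ∩ Hypergraph.V H f) →
      ⟦ ∣ Hypergraph.V H e ∩ Hypergraph.V H f ∣ ⟧ ℚ.≤ α ℚ.* ⟦ k ⟧ →
      ((size H e < k ⊎ size H f < k)
        ⊎ (2 ≤ ∣ Hypergraph.V H e ∩ Hypergraph.V H f ∣)
        ⊎ (Σ (Fin n) λ v → v ∈ (Hypergraph.V H e ∩ Hypergraph.V H f) ×
             (⟦ 4 ⟧ ℚ.* δ) ℚ.* ⟦ smallEdgesAt H k v ⟧ ℚ.≤ ⟦ t ⟧)) →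
      Useful H t e f))
proposition4p6 =
  ⅒ , 0<⅒ , λ α 0<α α<⅒ →
  ⅒ , 0<⅒ , λ δ 0<δ δ<⅒ → useful-for-small-parameters 0<α α<⅒ 0<δ δ<⅒
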